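{- Every $2$-tree $\nabla$ with $|V(\nabla)|\geq 4$ has a crystallized vertex.
   Context: A $2$-tree is a graph $\nabla$ which is either a $2$-vertex complete graph, or has $h>2$ vertices and admits a bijection $\varpi:\{1,\ldots,h\}\to V(\nabla)$ such that for every $i\in\{1,\ldots,h-2\}$, the set of neighbors of $\varpi(i)$ in $V(\nabla)\setminus\{\varpi(1),\ldots,\varpi(i)\}$ is a clique of size $2$. In a graph $H$, a vertex $z$ is crystallized if there is a $2$-clique $\{z_1,z_2\}\subseteq N_H(z)$ such that: (C1) $N_H(z)\setminus\{z_1,z_2\}$ is a non-empty stable set in $H$; and (C2) there is a partition $(S_1,S_2)$ of $N_H(z)\setminus\{z_1,z_2\}$ such that for each $i\in\{1,2\}$ and every $x\in S_i$, $N_H(x)=\{z_i,z\}$. Here $N_H(v)$ is the set of neighbors of $v$ in $H$. -}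

module Defs where

open import Data.Nat using (ℕ; _<_; _≥_)
open import Data.Fin using (Fin)
open import Data.Bool using (Bool; true; false)
open import Data.Product using (Σ; ∃; ∃-syntax; _×_; _,_)
open import Data.Sum using (_⊎_)
open import Data.Empty using (⊥)
open import Relation.Nullary using (¬_)
open import Relation.Binary.PropositionalEquality using (_≡_; _≢_)
open import Function.Bundles using (_⇔_)
open import Function.Definitions using (Bijective)
import Data.Fin as F

record Graph (n : ℕ) : Set where
  field
    adj    : Fin n → Fin n → Bool
    sym    : ∀ u v → adj u v ≡ adj v u
    irrefl : ∀ v → adj v v ≡ false

open Graph public

Adj : ∀ {n} → Graph n → Fin n → Fin n → Set
Adj H u v = adj H u v ≡ true

_∈N[_,_] : ∀ {n} → Fin n → Graph n → Fin n → Set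
u ∈N[ H , v ] = Adj H v u

Complete : ∀ {n} → Graph n → Set
Complete {n} H = ∀ (u v : Fin n) → u ≢ v → Adj H u v

-- ϖ is a bijection {1..h} → V (indices are 0-based here, Fin n),
-- such that for every i with i+1 ∈ {1,…,h-2} (0-based: toℕ i < n - 2, i.e.
-- 2 + toℕ i < n) the set of neighbours of ϖ(i) among the vertices not in
-- {ϖ(0),…,ϖ(i)} (= {ϖ(j) | i < j}) is a clique of size 2.
LaterNbrsAre2Clique : ∀ {n} → Graph n → (Fin n → Fin n) → Fin n → Set
LaterNbrsAre2Clique {n} H ϖ i =
  ∃[ a ] ∃[ b ] (a ≢ b × Adj H a b ×
    (∀ (v : Fin n) →
      ((v ∈N[ H , ϖ i ] × (∀ (j : Fin n) → ϖ j ≡ v → i F.< j)))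
      ⇔ (v ≡ a ⊎ v ≡ b)))

IsTwoTree : ∀ {n} → Graph n → Set
IsTwoTree {n} H =
  (n ≡ 2 × Complete H)
  ⊎ (2 < n × ∃[ ϖ ] (Bijective _≡_ _≡_ ϖ ×
        (∀ (i : Fin n) → 2 Data.Nat.+ F.toℕ i < n → LaterNbrsAre2Clique H ϖ i)))

NbrsMinus : ∀ {n} → Graph n → Fin n → Fin n → Fin n → Fin n → Set
NbrsMinus H z z₁ z₂ x = x ∈N[ H , z ] × x ≢ z₁ × x ≢ z₂

Crystallized : ∀ {n} → Graph n → Fin n → Set₁
Crystallized {n} H z =
  ∃[ z₁ ] ∃[ z₂ ] (
    z₁ ≢ z₂ × Adj H z₁ z₂ × z₁ ∈N[ H , z ] × z₂ ∈N[ H , z ] ×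
    (∃[ x ] NbrsMinus H z z₁ z₂ x) ×
    (∀ x y → NbrsMinus H z z₁ z₂ x → NbrsMinus H z z₁ z₂ y → ¬ Adj H x y) ×
    Σ (Fin n → Set) λ S₁ → Σ (Fin n → Set) λ S₂ →
      (∀ x → NbrsMinus H z z₁ z₂ x ⇔ (S₁ x ⊎ S₂ x)) ×
      (∀ x → S₁ x → S₂ x → ⊥) ×
      (∀ x → S₁ x → ∀ y → y ∈N[ H , x ] ⇔ (y ≡ z₁ ⊎ y ≡ z)) ×
      (∀ x → S₂ x → ∀ y → y ∈N[ H , x ] ⇔ (y ≡ z₂ ⊎ y ≡ z)))

{-# OPTIONS --safe #-}
module Submission where

-- Order the vertices by ϖ and let z be the lowest vertex that has a neighbour
-- below it.  Every vertex x below z then has no lower neighbour, so its only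
-- neighbours are the two vertices of the clique it is attached to; if x is
-- adjacent to z, the other one lies above z.  Hence if z is itself peeled
-- (one of ϖ(1), …, ϖ(h-2)), its lower neighbours hang on the clique {a, b}
-- above z and z is crystallized with z₁ = a, z₂ = b.  Otherwise no peeled
-- vertex has a lower neighbour, every peeled vertex is adjacent to exactly the
-- last two vertices a, b, and a is crystallized with z₁ = b and z₂ = ϖ(1).

open import Defs hiding (sym)
open import Data.Nat as ℕ using (ℕ; _<_; _≥_; _+_; s≤s; z≤n)
import Data.Nat.Properties as ℕ
open import Data.Fin as Fin using (Fin; toℕ)
import Data.Fin.Properties as Fin
open import Data.Fin.Induction using (<-wellFounded)
open import Data.Fin.Patterns using (0F; 1F)
open import Data.Bool using (true)
import Data.Bool.Properties as Bool
open import Data.Product using (Σ-syntax; ∃-syntax; _×_; _,_; proj₁; proj₂)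
open import Data.Sum using (_⊎_; inj₁; inj₂; [_,_]′) renaming (map to ⊎-map; swap to ⊎-swap)
open import Data.Empty using (⊥)
open import Level using (0ℓ)
open import Function using (_∘_)
open import Function.Bundles using (_⇔_; mk⇔; Equivalence)
import Function.Properties.Equivalence as ⇔
open import Function.Definitions using (Bijective)
open import Induction.WellFounded using (WellFounded; Acc; acc)
open import Relation.Nullary using (¬_; yes; no; contradiction)
open import Relation.Nullary.Decidable using (_×-dec_; decidable-stable)
open import Relation.Unary using (Pred; Decidable)
open import Relation.Binary using (Rel)
import Relation.Binary.Definitions as B
open import Relation.Binary.Definitions using (tri<; tri≈; tri>)
import Relation.Binary.Construct.On as On
open import Relation.Binary.PropositionalEquality
  using (_≡_; _≢_; refl; sym; trans; cong; subst)

open Equivalence using (to; from)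

top-two : ∀ {n x} → x < n → ¬ 2 + x < n → 1 + x ≡ n ⊎ 2 + x ≡ n
top-two x<n x≮ with ℕ.m≤n⇒m<n∨m≡n x<n
... | inj₁ 1+x<n = inj₂ (ℕ.≤-antisym 1+x<n (ℕ.≮⇒≥ x≮))
... | inj₂ 1+x≡n = inj₁ 1+x≡n

last-two : ∀ {n x y w} → x < n → y < n → w < n →
           ¬ 2 + x < n → ¬ 2 + y < n → ¬ 2 + w < n → x ≢ y → w ≡ x ⊎ w ≡ y
last-two {n} {x} {y} {w} x<n y<n w<n x≮ y≮ w≮ x≢y =
  pick (top-two x<n x≮) (top-two y<n y≮) (top-two w<n w≮)
  where
  cancel : ∀ k {a b} → k + a ≡ n → k + b ≡ n → a ≡ b
  cancel k {a} {b} p q = ℕ.+-cancelˡ-≡ k a b (trans p (sym q))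

  pick : 1 + x ≡ n ⊎ 2 + x ≡ n → 1 + y ≡ n ⊎ 2 + y ≡ n → 1 + w ≡ n ⊎ 2 + w ≡ n →
         w ≡ x ⊎ w ≡ y
  pick (inj₁ p) (inj₁ q) _        = contradiction (cancel 1 p q) x≢y
  pick (inj₂ p) (inj₂ q) _        = contradiction (cancel 2 p q) x≢y
  pick (inj₁ p) (inj₂ _) (inj₁ r) = inj₁ (cancel 1 r p)
  pick (inj₁ _) (inj₂ q) (inj₂ r) = inj₂ (cancel 2 r q)
  pick (inj₂ _) (inj₁ q) (inj₁ r) = inj₂ (cancel 1 r q)
  pick (inj₂ p) (inj₁ _) (inj₂ r) = inj₁ (cancel 2 r p)

minimal-witness : ∀ {n r p} {_≺_ : Rel (Fin n) r} {P : Pred (Fin n) p} →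
                  WellFounded _≺_ → B.Decidable _≺_ → Decidable P →
                  ∀ {k} → P k → ∃[ m ] (P m × (∀ j → j ≺ m → ¬ P j))
minimal-witness {_≺_ = _≺_} {P} wf _≺?_ P? {k} Pk = go (wf k) Pk
  where
  go : ∀ {k} → Acc _≺_ k → P k → ∃[ m ] (P m × (∀ j → j ≺ m → ¬ P j))
  go {k} (acc rs) Pk with Fin.any? (λ j → (j ≺? k) ×-dec P? j)
  ... | yes (j , j≺k , Pj) = go (rs j≺k) Pj
  ... | no ∄j              = k , Pk , λ j j≺k Pj → ∄j (j , j≺k , Pj)

module _ {n} (H : Graph n) where

  adj-sym : ∀ {u v} → Adj H u v → Adj H v u
  adj-sym {u} {v} u~v = trans (Graph.sym H v u) u~v

  adj⇒≢ : ∀ {u v} → Adj H u v → u ≢ v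
  adj⇒≢ {u} u~u refl = contradiction (trans (sym u~u) (irrefl H u)) λ ()

  NbrsExactly : Fin n → Fin n → Fin n → Set
  NbrsExactly x u v = ∀ y → y ∈N[ H , x ] ⇔ (y ≡ u ⊎ y ≡ v)

  NbrsExactly-¬adj : ∀ {x u z y} → NbrsExactly x u z → y ≢ u → Adj H z y → ¬ Adj H x y
  NbrsExactly-¬adj N y≢u z~y x~y with to (N _) x~y
  ... | inj₁ y≡u = y≢u y≡u
  ... | inj₂ refl = adj⇒≢ z~y refl

  crystallized-by-ears : ∀ {z z₁ z₂} → z₁ ≢ z₂ → Adj H z₁ z₂ → z₁ ∈N[ H , z ] → z₂ ∈N[ H , z ] →
                         (∃[ x ] NbrsMinus H z z₁ z₂ x) →
                         (∀ {x} → NbrsMinus H z z₁ z₂ x → NbrsExactly x z₁ z ⊎ NbrsExactly x z₂ z) →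
                         Crystallized H z
  crystallized-by-ears {z} {z₁} {z₂} z₁≢z₂ z₁~z₂ z~z₁ z~z₂ nonempty ear =
    z₁ , z₂ , z₁≢z₂ , z₁~z₂ , z~z₁ , z~z₂ , nonempty , stable , S₁ , S₂ ,
    (λ _ → mk⇔ (λ r → ⊎-map (r ,_) (r ,_) (ear r)) [ proj₁ , proj₁ ]′) ,
    disjoint , (λ _ → proj₂) , (λ _ → proj₂)
    where
    Rest : Fin n → Set
    Rest = NbrsMinus H z z₁ z₂

    S₁ S₂ : Fin n → Set
    S₁ x = Rest x × NbrsExactly x z₁ z
    S₂ x = Rest x × NbrsExactly x z₂ z

    stable : ∀ x y → Rest x → Rest y → ¬ Adj H x y
    stable x y rx (z~y , y≢z₁ , y≢z₂) with ear rx
    ... | inj₁ N = NbrsExactly-¬adj N y≢z₁ z~y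
    ... | inj₂ N = NbrsExactly-¬adj N y≢z₂ z~y

    disjoint : ∀ x → S₁ x → S₂ x → ⊥
    disjoint x (_ , N₁) (_ , N₂) =
      NbrsExactly-¬adj N₂ z₁≢z₂ z~z₁ (from (N₁ z₁) (inj₁ refl))

module EliminationOrdering {n} (T : Graph n) (ϖ : Fin n → Fin n) (ϖ-bij : Bijective _≡_ _≡_ ϖ)
  (peel : ∀ i → 2 + toℕ i < n → LaterNbrsAre2Clique T ϖ i) where

  rank : Fin n → Fin n
  rank v = proj₁ (proj₂ ϖ-bij v)

  ϖ-rank : ∀ v → ϖ (rank v) ≡ v
  ϖ-rank v = proj₂ (proj₂ ϖ-bij v) refl

  rank-ϖ : ∀ i → rank (ϖ i) ≡ i
  rank-ϖ i = proj₁ ϖ-bij (ϖ-rank (ϖ i))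

  rank-injective : ∀ {u v} → rank u ≡ rank v → u ≡ v
  rank-injective {u} {v} eq = trans (sym (ϖ-rank u)) (trans (cong ϖ eq) (ϖ-rank v))

  _≺_ : Rel (Fin n) 0ℓ
  u ≺ v = rank u Fin.< rank v

  _≺?_ : B.Decidable _≺_
  u ≺? v = rank u Fin.<? rank v

  ≺-wellFounded : WellFounded _≺_
  ≺-wellFounded = On.wellFounded rank <-wellFounded

  ≺-asym : ∀ {u v} → u ≺ v → ¬ v ≺ u
  ≺-asym = Fin.<-asym

  ≢⇒⊀⇒≻ : ∀ {u v} → u ≢ v → ¬ u ≺ v → v ≺ u
  ≢⇒⊀⇒≻ {u} {v} u≢v u⊀v with Fin.<-cmp (rank u) (rank v)
  ... | tri< u≺v _ _ = contradiction u≺v u⊀v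
  ... | tri≈ _ eq _  = contradiction (rank-injective eq) u≢v
  ... | tri> _ _ v≺u = v≺u

  ϖ-later⇔≺ : ∀ {v w} → (∀ j → ϖ j ≡ w → rank v Fin.< j) ⇔ v ≺ w
  ϖ-later⇔≺ {v} {w} = mk⇔ (λ later → later (rank w) (ϖ-rank w))
                          (λ { v≺w j refl → subst (rank v Fin.<_) (rank-ϖ j) v≺w })

  -- The vertices ϖ(1), …, ϖ(h-2) of the paper, i.e. all but the last two.
  Peeled : Fin n → Set
  Peeled v = 2 + toℕ (rank v) < n

  peeled? : Decidable Peeled
  peeled? v = 2 + toℕ (rank v) ℕ.<? n

  peeled-ϖ : ∀ i → 2 + toℕ i < n → Peeled (ϖ i)
  peeled-ϖ i = subst (λ j → 2 + toℕ j < n) (sym (rank-ϖ i))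

  peeled-≺-unpeeled : ∀ {u v} → Peeled u → ¬ Peeled v → u ≺ v
  peeled-≺-unpeeled u-peeled v-unpeeled =
    ℕ.+-cancelˡ-< 2 _ _ (ℕ.<-≤-trans u-peeled (ℕ.≮⇒≥ v-unpeeled))

  peeled-downward : ∀ {u v} → u ≺ v → Peeled v → Peeled u
  peeled-downward u≺v = ℕ.<-trans (ℕ.+-monoʳ-< 2 u≺v)

  unpeeled-pair : ∀ {p q} → ¬ Peeled p → ¬ Peeled q → p ≢ q →
                  ∀ y → (¬ Peeled y) ⇔ (y ≡ p ⊎ y ≡ q)
  unpeeled-pair {p} {q} p↑ q↑ p≢q y = mk⇔ to′ λ { (inj₁ refl) → p↑ ; (inj₂ refl) → q↑ }
    where
    rank-toℕ-injective : ∀ {u v} → toℕ (rank u) ≡ toℕ (rank v) → u ≡ v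
    rank-toℕ-injective = rank-injective ∘ Fin.toℕ-injective

    to′ : ¬ Peeled y → y ≡ p ⊎ y ≡ q
    to′ y↑ = ⊎-map rank-toℕ-injective rank-toℕ-injective
               (last-two (Fin.toℕ<n (rank p)) (Fin.toℕ<n (rank q)) (Fin.toℕ<n (rank y))
                         p↑ q↑ y↑ (p≢q ∘ rank-toℕ-injective))

  record UpperClique (v : Fin n) : Set where
    field
      a b   : Fin n
      a≢b   : a ≢ b
      a~b   : Adj T a b
      v~a   : Adj T v a
      v~b   : Adj T v b
      v≺a   : v ≺ a
      v≺b   : v ≺ b
      upper : ∀ {w} → Adj T v w → v ≺ w → w ≡ a ⊎ w ≡ b

  swap : ∀ {v} → UpperClique v → UpperClique v
  swap U = record
    { a = b ; b = a ; a≢b = a≢b ∘ sym ; a~b = adj-sym T a~b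
    ; v~a = v~b ; v~b = v~a ; v≺a = v≺b ; v≺b = v≺a
    ; upper = λ v~w v≺w → ⊎-swap (upper v~w v≺w) }
    where open UpperClique U

  upperClique : ∀ {v} → Peeled v → UpperClique v
  upperClique {v} v-peeled with peel (rank v) v-peeled
  ... | a , b , a≢b , a~b , later = record
    { a = a ; b = b ; a≢b = a≢b ; a~b = a~b
    ; v~a = adj-from-ϖ (proj₁ (from (later a) (inj₁ refl)))
    ; v~b = adj-from-ϖ (proj₁ (from (later b) (inj₂ refl)))
    ; v≺a = to ϖ-later⇔≺ (proj₂ (from (later a) (inj₁ refl)))
    ; v≺b = to ϖ-later⇔≺ (proj₂ (from (later b) (inj₂ refl)))
    ; upper = λ {w} v~w v≺w →
        to (later w) (subst (λ u → Adj T u w) (sym (ϖ-rank v)) v~w , from ϖ-later⇔≺ v≺w) }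
    where
    adj-from-ϖ : ∀ {w} → Adj T (ϖ (rank v)) w → Adj T v w
    adj-from-ϖ {w} = subst (λ u → Adj T u w) (ϖ-rank v)

  HasLowerNbr : Fin n → Set
  HasLowerNbr v = ∃[ u ] (u ≺ v × Adj T u v)

  hasLowerNbr? : Decidable HasLowerNbr
  hasLowerNbr? v = Fin.any? λ u → (u ≺? v) ×-dec (adj T u v Bool.≟ true)

  upper-hasLowerNbr : ∀ {v} (U : UpperClique v) → HasLowerNbr (UpperClique.a U)
  upper-hasLowerNbr {v} U = v , UpperClique.v≺a U , UpperClique.v~a U

  nbr-above : ∀ {x y} → ¬ HasLowerNbr x → Adj T x y → x ≺ y
  nbr-above no-lower x~y =
    ≢⇒⊀⇒≻ (adj⇒≢ T (adj-sym T x~y)) λ y≺x → no-lower (_ , y≺x , adj-sym T x~y)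

  nbrs-without-lower : ∀ {x} (U : UpperClique x) → ¬ HasLowerNbr x →
                       NbrsExactly T x (UpperClique.a U) (UpperClique.b U)
  nbrs-without-lower U no-lower y =
    mk⇔ (λ x~y → upper x~y (nbr-above no-lower x~y))
        λ { (inj₁ refl) → v~a ; (inj₂ refl) → v~b }
    where open UpperClique U

  upperClique-through : ∀ {x z} → Peeled x → Adj T x z → x ≺ z →
                        Σ[ U ∈ UpperClique x ] UpperClique.b U ≡ z
  upperClique-through {x} {z} x-peeled x~z x≺z = orient (upperClique x-peeled)
    where
    orient : UpperClique x → Σ[ U ∈ UpperClique x ] UpperClique.b U ≡ z
    orient U with UpperClique.upper U x~z x≺z
    ... | inj₁ z≡a = swap U , sym z≡a
    ... | inj₂ z≡b = U , sym z≡b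

  NoLowerNbrBelow : Fin n → Set
  NoLowerNbrBelow z = ∀ k → k ≺ z → ¬ HasLowerNbr k

  -- The second neighbour w of x has the lower neighbour x, so it cannot lie below z.
  lower-nbr-is-ear : ∀ {x z} → NoLowerNbrBelow z → Peeled x → x ≺ z → Adj T x z →
                     ∃[ w ] (z ≺ w × Adj T z w × NbrsExactly T x w z)
  lower-nbr-is-ear z-min x-peeled x≺z x~z with upperClique-through x-peeled x~z x≺z
  ... | U , refl = a , z≺a , adj-sym T a~b , nbrs-without-lower U (z-min _ x≺z)
    where
    open UpperClique U
    z≺a : b ≺ a
    z≺a = ≢⇒⊀⇒≻ a≢b λ a≺b → z-min a a≺b (_ , v≺a , v~a)

  crystallized-peeled : ∀ {z} → Peeled z → HasLowerNbr z → NoLowerNbrBelow z → Crystallized T z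
  crystallized-peeled {z} z-peeled (u , u≺z , u~z) z-min =
    crystallized-by-ears T a≢b a~b v~a v~b (u , adj-sym T u~z , below-≢ v≺a , below-≢ v≺b) ear
    where
    open UpperClique (upperClique z-peeled)

    below-≢ : ∀ {c} → z ≺ c → u ≢ c
    below-≢ z≺u refl = ≺-asym u≺z z≺u

    below : ∀ {x} → Adj T z x → x ≢ a → x ≢ b → x ≺ z
    below z~x x≢a x≢b = ≢⇒⊀⇒≻ (adj⇒≢ T z~x) λ z≺x → [ x≢a , x≢b ]′ (upper z~x z≺x)

    ear : ∀ {x} → NbrsMinus T z a b x → NbrsExactly T x a z ⊎ NbrsExactly T x b z
    ear (z~x , x≢a , x≢b) with x≺z ← below z~x x≢a x≢b
                          with lower-nbr-is-ear z-min (peeled-downward x≺z z-peeled) x≺z (adj-sym T z~x)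
    ... | w , z≺w , z~w , N with upper z~w z≺w
    ... | inj₁ refl = inj₁ N
    ... | inj₂ refl = inj₂ N

  NoPeeledHasLowerNbr : Set
  NoPeeledHasLowerNbr = ∀ k → Peeled k → ¬ HasLowerNbr k

  nbrs-of-peeled : NoPeeledHasLowerNbr → ∀ {k} → Peeled k → ∀ y → Adj T k y ⇔ (¬ Peeled y)
  nbrs-of-peeled no-lower {k} k-peeled y = mk⇔ nbr-unpeeled unpeeled-nbr
    where
    open UpperClique (upperClique k-peeled)

    nbr-unpeeled : ∀ {w} → Adj T k w → ¬ Peeled w
    nbr-unpeeled k~w w-peeled =
      no-lower _ w-peeled (k , nbr-above (no-lower k k-peeled) k~w , k~w)

    unpeeled-nbr : ¬ Peeled y → Adj T k y
    unpeeled-nbr y↑ with to (unpeeled-pair (nbr-unpeeled v~a) (nbr-unpeeled v~b) a≢b y) y↑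
    ... | inj₁ refl = v~a
    ... | inj₂ refl = v~b

  crystallized-book : NoPeeledHasLowerNbr → ∀ {v₀ v₁} → Peeled v₀ → Peeled v₁ → v₀ ≢ v₁ →
                      ∃[ z ] Crystallized T z
  crystallized-book no-lower {v₀} {v₁} v₀-peeled v₁-peeled v₀≢v₁ =
    a , crystallized-by-ears T b≢v₀ (adj-sym T v~b) a~b (adj-sym T v~a)
          (v₁ , a~v₁ , (λ { refl → b↑ v₁-peeled }) , v₀≢v₁ ∘ sym) ear
    where
    open UpperClique (upperClique v₀-peeled)

    nbrs : ∀ {k} → Peeled k → ∀ y → Adj T k y ⇔ (¬ Peeled y)
    nbrs = nbrs-of-peeled no-lower

    a↑ : ¬ Peeled a
    a↑ = to (nbrs v₀-peeled a) v~a

    b↑ : ¬ Peeled b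
    b↑ = to (nbrs v₀-peeled b) v~b

    b≢v₀ : b ≢ v₀
    b≢v₀ b≡v₀ = b↑ (subst Peeled (sym b≡v₀) v₀-peeled)

    a~v₁ : Adj T a v₁
    a~v₁ = adj-sym T (from (nbrs v₁-peeled a) a↑)

    ear : ∀ {x} → NbrsMinus T a b v₀ x → NbrsExactly T x b a ⊎ NbrsExactly T x v₀ a
    ear {x} (a~x , x≢b , _) =
      inj₁ λ y → ⇔.trans (nbrs x-peeled y) (unpeeled-pair b↑ a↑ (a≢b ∘ sym) y)
      where
      x-peeled : Peeled x
      x-peeled = decidable-stable (peeled? x) λ x↑ →
        [ adj⇒≢ T a~x ∘ sym , x≢b ]′ (to (unpeeled-pair a↑ b↑ a≢b x) x↑)

  crystallized-exists : ∀ {v₀ v₁} → Peeled v₀ → Peeled v₁ → v₀ ≢ v₁ → ∃[ z ] Crystallized T z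
  crystallized-exists v₀-peeled v₁-peeled v₀≢v₁
    with z , z-low , z-min ← minimal-witness ≺-wellFounded _≺?_ hasLowerNbr?
                               (upper-hasLowerNbr (upperClique v₀-peeled))
    with peeled? z
  ... | yes z-peeled = z , crystallized-peeled z-peeled z-low z-min
  ... | no z↑ = crystallized-book (λ k k-peeled → z-min k (peeled-≺-unpeeled k-peeled z↑))
                                  v₀-peeled v₁-peeled v₀≢v₁

theorem3p4 : ∀ (n : ℕ) (T : Graph n) → IsTwoTree T → n ≥ 4 → ∃[ z ] Crystallized T z
theorem3p4 n T (inj₁ (refl , _)) (s≤s (s≤s ()))
theorem3p4 n T (inj₂ (_ , ϖ , ϖ-bij , peel)) (s≤s (s≤s (s≤s (s≤s _)))) =
  crystallized-exists (peeled-ϖ 0F (s≤s (s≤s (s≤s z≤n)))) (peeled-ϖ 1F (s≤s (s≤s (s≤s (s≤s z≤n)))))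
                      (λ ϖ0≡ϖ1 → contradiction (proj₁ ϖ-bij ϖ0≡ϖ1) λ ())
  where open EliminationOrdering T ϖ ϖ-bij peel
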